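{- Let $\Sigma$ be a finite alphabet, $\mathcal{U}$ a set, and $\gamma:\mathcal{U}\to\Sigma^{\ast}$ a map; call $\mathcal{T}=(\mathcal{U},\Sigma,\gamma)$ a th\'eorie langagi\`ere. Let $\mathfrak{U}_{\mathcal{T}}$ be the smallest $\sigma$-algebra on $\mathcal{U}$ containing all the sets $\gamma^{ -1}(w)$, $w\in\Sigma^{\ast}$. For all $R,S\subseteq\mathcal{U}$: if "$R=S$" is provable in $\mathcal{T}$, then "$R=S$" is provable in ZFC. Here "$R=S$" is provable in $\mathcal{T}$ means that the statements "$R,S\in\mathfrak{U}_{\mathcal{T}}$" and "$\gamma(R)=\gamma(S)$" are both provable in ZFC.
   Context: $\Sigma^{\ast}$ denotes the free monoid of finite words over $\Sigma$; $\gamma(R)=\{\gamma(r): r\in R\}$. -}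

module Defs where

open import Level using (0ℓ)
open import Data.Nat using (ℕ)
open import Data.Fin using (Fin)
open import Data.List using (List)
open import Data.Product using (Σ; ∃; _×_)
open import Function.Bundles using (_↔_; _⇔_)
open import Relation.Unary using (Pred; _∈_; U; ∁; ⋃)
open import Relation.Binary.PropositionalEquality using (_≡_)

IsFinite : Set → Set
IsFinite A = Σ ℕ λ k → A ↔ Fin k

Word : Set → Set
Word Σ' = List Σ'

Subset : Set → Set₁
Subset X = Pred X 0ℓ

record IsSigmaAlgebra {X : Set} (𝒜 : Subset X → Set₁) : Set₁ where
  field
    whole : 𝒜 U
    compl : ∀ {A} → 𝒜 A → 𝒜 (∁ A)
    union : (A : ℕ → Subset X) → (∀ n → 𝒜 (A n)) → 𝒜 (⋃ ℕ A)

fiber : {X W : Set} → (X → W) → W → Subset X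
fiber γ w = λ u → γ u ≡ w

-- 𝔘_T : the smallest σ-algebra on 𝒰 containing all γ⁻¹(w), w ∈ Σ*
-- (intersection of all such σ-algebras).
𝔘 : {𝒰 Σ' : Set} → (𝒰 → Word Σ') → Subset 𝒰 → Set₂
𝔘 {𝒰} {Σ'} γ R =
  (𝒜 : Subset 𝒰 → Set₁) → IsSigmaAlgebra 𝒜 →
  ((w : Word Σ') → 𝒜 (fiber γ w)) → 𝒜 R

image : {X W : Set} → (X → W) → Subset X → Pred W 0ℓ
image γ R = λ w → ∃ λ r → r ∈ R × γ r ≡ w

_≗ˢ_ : {X : Set} → Subset X → Subset X → Set
R ≗ˢ S = ∀ x → (x ∈ R) ⇔ (x ∈ S)

module Submission where

-- A set in 𝔘_T is a union of fibres of γ: the γ-saturated sets form a σ-algebra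
-- containing every fibre γ⁻¹(w), hence contain 𝔘_T.  A saturated set R is
-- recovered from its image as γ⁻¹(γ(R)), so two such sets with the same image
-- are equal.

open import Defs
open import Level using (Lift; lift; lower)
open import Data.Product using (_,_)
open import Function.Bundles using (mk⇔; Equivalence)
open import Relation.Unary using (_⊆_)
open import Relation.Binary.PropositionalEquality using (_≡_; refl; sym; trans)

Saturated : {X W : Set} → (X → W) → Subset X → Set
Saturated γ A = ∀ x y → γ x ≡ γ y → A x → A y

saturated-isSigmaAlgebra : {X W : Set} (γ : X → W) →
  IsSigmaAlgebra (λ A → Lift _ (Saturated γ A))
saturated-isSigmaAlgebra γ = record
  { whole = lift λ _ _ _ _ → _
  ; compl = λ s → lift λ x y γx≡γy ¬Ax Ay → ¬Ax (lower s y x (sym γx≡γy) Ay)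
  ; union = λ A s → lift λ { x y γx≡γy (n , Anx) → n , lower (s n) x y γx≡γy Anx }
  }

fiber-saturated : {X W : Set} (γ : X → W) (w : W) → Saturated γ (fiber γ w)
fiber-saturated γ w x y γx≡γy γx≡w = trans (sym γx≡γy) γx≡w

𝔘⇒saturated : {X Σ' : Set} (γ : X → Word Σ') {R : Subset X} →
  𝔘 γ R → Saturated γ R
𝔘⇒saturated γ R∈𝔘 =
  lower (R∈𝔘 _ (saturated-isSigmaAlgebra γ) λ w → lift (fiber-saturated γ w))

image-⊆⇒⊆ : {X W : Set} (γ : X → W) {R S : Subset X} → Saturated γ S →
  image γ R ⊆ image γ S → R ⊆ S
image-⊆⇒⊆ γ S-sat γR⊆γS {x} Rx with γR⊆γS (x , Rx , refl)
... | s , Ss , γs≡γx = S-sat s x γs≡γx Ss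

lemma8 : (𝒰 Σ' : Set) → IsFinite Σ' → (γ : 𝒰 → Word Σ') →
    (R S : Subset 𝒰) → 𝔘 γ R → 𝔘 γ S →
    image γ R ≗ˢ image γ S → R ≗ˢ S
lemma8 𝒰 Σ' _ γ R S R∈𝔘 S∈𝔘 γR≗γS x = mk⇔
  (image-⊆⇒⊆ γ (𝔘⇒saturated γ S∈𝔘) (Equivalence.to (γR≗γS _)))
  (image-⊆⇒⊆ γ (𝔘⇒saturated γ R∈𝔘) (Equivalence.from (γR≗γS _)))
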